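{- For integers $n\ge 0$, $i\ge 0$, let $\beta_{n,i}$ be the number of standard Young tableaux with $n$ cells, at most three columns, whose shape is $(n-i-2k,\,i+k,\,k)$ for some integer $k\ge 0$ (i.e. the second column is exactly $i$ longer than the third); $\beta_{n,i}=0$ if there is no such shape. Then for every $n\ge 1$, $$\beta_{n,0}=\beta_{n-1,0}+\beta_{n-1,1},$$ and for every $n\ge 2$ and $1\le i\le \lfloor n/2\rfloor$, $$\beta_{n,i}=\beta_{n-1,i-1}+\beta_{n-1,i}+\beta_{n-1,i+1}-r_{n,i},$$ where $r_{n,i}$ is the number of standard Young tableaux of shape $\left(\frac{n+i-2}{3},\frac{n+i-2}{3},\frac{n-2i+1}{3}\right)$ if $n-2i\equiv 2 \pmod 3$, and $r_{n,i}=0$ otherwise.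
   Context: The shape of a standard Young tableau is written as the list of its column lengths $(c_1,c_2,c_3)$ with $c_1\ge c_2\ge c_3\ge 0$ (zero entries meaning absent columns). The number of standard Young tableaux of a list that is not a valid (weakly decreasing, nonnegative) shape is $0$. -}

module Defs where

open import Data.Nat using (ℕ; zero; suc; _+_; _*_; _∸_; _≤_; _≤?_; _≟_; _/_; _%_)
open import Data.Nat.ListAction using (sum)
open import Data.Nat.Properties using ()
open import Data.Fin using (Fin; zero; suc)
open import Data.Fin.Properties using () renaming (_≟_ to _≟ᶠ_)
open import Data.List using (List; []; _∷_; length; filter; map; concatMap; take; upTo)
open import Data.List.Relation.Unary.All using (All)
open import Data.List.Relation.Unary.All using () renaming (all? to all?)
open import Data.Product using (_×_; _,_)
open import Relation.Nullary using (Dec; yes; no; _×-dec_)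
open import Relation.Binary.PropositionalEquality using (_≡_)

-- Shapes with at most three columns, written as column lengths (c₁ , c₂ , c₃).
Shape : Set
Shape = ℕ × ℕ × ℕ

IsShape : Shape → Set
IsShape (a , b , c) = (b ≤ a) × (c ≤ b)

isShape? : (s : Shape) → Dec (IsShape s)
isShape? (a , b , c) = (b ≤? a) ×-dec (c ≤? b)

-- Encoding of a filling of a ≤3-column diagram with 1,…,n:
-- a word w = w₁ … wₙ over Fin 3, where wₖ is the column containing the entry k.
-- Within each column the entries are placed top to bottom in increasing order
-- (so columns strictly increase automatically).  The cells filled by the
-- entries 1..k then have column lengths  shapeOf (take k w).
count : Fin 3 → List (Fin 3) → ℕ
count j [] = 0
count j (x ∷ w) with x ≟ᶠ j
... | yes _ = suc (count j w)
... | no  _ = count j w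

shapeOf : List (Fin 3) → Shape
shapeOf w = count zero w , count (suc zero) w , count (suc (suc zero)) w

-- Rows increase left to right  ⇔  for every k the cells holding 1..k form
-- a Young diagram, i.e. every prefix has weakly decreasing column lengths.
IsSYT : Shape → List (Fin 3) → Set
IsSYT s w = (shapeOf w ≡ s) × All (λ k → IsShape (shapeOf (take k w))) (upTo (suc (length w)))

shape≟ : (s t : Shape) → Dec (s ≡ t)
shape≟ (a , b , c) (a' , b' , c') with a ≟ a' | b ≟ b' | c ≟ c'
... | yes Relation.Binary.PropositionalEquality.refl | yes Relation.Binary.PropositionalEquality.refl | yes Relation.Binary.PropositionalEquality.refl = yes Relation.Binary.PropositionalEquality.refl
... | no p | _ | _ = no (λ { Relation.Binary.PropositionalEquality.refl → p Relation.Binary.PropositionalEquality.refl })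
... | yes _ | no p | _ = no (λ { Relation.Binary.PropositionalEquality.refl → p Relation.Binary.PropositionalEquality.refl })
... | yes _ | yes _ | no p = no (λ { Relation.Binary.PropositionalEquality.refl → p Relation.Binary.PropositionalEquality.refl })

isSYT? : (s : Shape) → (w : List (Fin 3)) → Dec (IsSYT s w)
isSYT? s w = shape≟ (shapeOf w) s ×-dec all? (λ k → isShape? (shapeOf (take k w))) (upTo (suc (length w)))

words : ℕ → List (List (Fin 3))
words zero = [] ∷ []
words (suc n) = concatMap (λ w → map (_∷ w) (zero ∷ suc zero ∷ suc (suc zero) ∷ [])) (words n)

-- Number of standard Young tableaux of shape (c₁ , c₂ , c₃)
-- (automatically 0 if the list is not weakly decreasing).
syt : ℕ → ℕ → ℕ → ℕ
syt a b c = length (filter (isSYT? (a , b , c)) (words (a + b + c)))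

-- β n i = Σ_{k ≥ 0, i + 2k ≤ n} syt (n - i - 2k) (i + k) k
-- (shapes with n - i - 2k < 0 do not exist; k ≤ n covers all possible k).
βterm : ℕ → ℕ → ℕ → ℕ
βterm n i k with (i + 2 * k) ≤? n
... | yes _ = syt (n ∸ (i + 2 * k)) (i + k) k
... | no  _ = 0

β : ℕ → ℕ → ℕ
β n i = sum (map (βterm n i) (upTo (suc n)))

-- r n i = syt ((n+i-2)/3) ((n+i-2)/3) ((n-2i+1)/3) if n - 2i ≡ 2 (mod 3), else 0.
-- Only used for 2i ≤ n; then all three quantities are exact natural divisions.
r : ℕ → ℕ → ℕ
r n i with ((n ∸ 2 * i) % 3) ≟ 2
... | yes _ = syt ((n + i ∸ 2) / 3) ((n + i ∸ 2) / 3) ((n ∸ 2 * i + 1) / 3)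
... | no  _ = 0

-- Deleting the largest entry of a standard Young tableau removes a corner cell; on words it deletes
-- the last letter. Hence for a nonempty shape s, syt s is the sum over the three columns of syt of s
-- with a cell removed from that column. Applied to the shapes (n−i−2k, i+k, k) counted by β n i,
-- removal from columns 1, 2 and 3 yields exactly the shapes counted by β (n−1) i, β (n−1) (i−1) and
-- β (n−1) (i+1). The only defect is that the removal sum need not vanish on lists that are not
-- shapes: for (a, b+1, c) with c ≤ b and a ≤ b only column 2 contributes, and only when a = b, namely
-- syt (b, b, c). Among the lists (n−i−2k, i+k, k) with i ≥ 1 this happens for a single k, exactly
-- when n − 2i ≡ 2 (mod 3), and that contribution is r n i; for i = 0 it never happens.

module Submission where

open import Defs
open import Algebra.Properties.CommutativeSemigroup using (interchange)
open import Data.Nat using (ℕ; zero; suc; _+_; _*_; _∸_; _≤_; _<_; z≤n; s≤s; _≤?_; _≟_; _/_; _%_)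
open import Data.Nat.Properties
open import Data.Nat.DivMod using (m≡m%n+[m/n]*n; [m+kn]%n≡m%n; m*n/n≡m; m/n*n≤m)
open import Data.Nat.ListAction using (sum)
open import Data.Nat.ListAction.Properties using (sum-++)
open import Data.Nat.Tactic.RingSolver using (solve-∀)
open import Data.Fin using (Fin; zero; suc)
open import Data.Fin.Properties using () renaming (_≟_ to _≟ᶠ_)
open import Data.List using (List; []; _∷_; _++_; _∷ʳ_; length; filter; map; concatMap; take; applyUpTo; allFin)
open import Data.List.Properties using (map-upTo; applyUpTo-∷ʳ; map-++; map-cong; take-all)
open import Data.List.Relation.Unary.All.Properties using (applyUpTo⁺₁; applyUpTo⁻)
open import Data.Product using (_×_; _,_; proj₁; proj₂)
open import Data.Sum using (inj₁; inj₂)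
open import Function using (_∘_)
open import Relation.Nullary using (Dec; yes; no; ¬_; contradiction)
open import Relation.Unary using (Decidable)
open import Relation.Binary.PropositionalEquality

∑< : ℕ → (ℕ → ℕ) → ℕ
∑< n f = sum (applyUpTo f n)

syntax ∑< n (λ k → e) = ∑[ k < n ] e

∑-cong : ∀ n {f g : ℕ → ℕ} → (∀ k → f k ≡ g k) → ∑< n f ≡ ∑< n g
∑-cong zero    f≗g = refl
∑-cong (suc n) f≗g = cong₂ _+_ (f≗g 0) (∑-cong n (f≗g ∘ suc))

∑-distrib-+ : ∀ n (f g : ℕ → ℕ) → ∑[ k < n ] (f k + g k) ≡ ∑< n f + ∑< n g
∑-distrib-+ zero    f g = refl
∑-distrib-+ (suc n) f g =
  trans (cong (f 0 + g 0 +_) (∑-distrib-+ n (f ∘ suc) (g ∘ suc)))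
        (interchange +-commutativeSemigroup (f 0) (g 0) (∑< n (f ∘ suc)) (∑< n (g ∘ suc)))

∑-zero : ∀ n {f : ℕ → ℕ} → (∀ k → f k ≡ 0) → ∑< n f ≡ 0
∑-zero zero    f≗0 = refl
∑-zero (suc n) f≗0 = cong₂ _+_ (f≗0 0) (∑-zero n (f≗0 ∘ suc))

∑-last : ∀ n (f : ℕ → ℕ) → ∑< (suc n) f ≡ ∑< n f + f n
∑-last n f = begin
  sum (applyUpTo f (suc n))        ≡⟨ cong sum (applyUpTo-∷ʳ f n) ⟨
  sum (applyUpTo f n ∷ʳ f n)       ≡⟨ sum-++ (applyUpTo f n) _ ⟩
  ∑< n f + (f n + 0)               ≡⟨ cong (∑< n f +_) (+-identityʳ (f n)) ⟩
  ∑< n f + f n                     ∎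
  where open ≡-Reasoning

∑-single : ∀ n {f : ℕ → ℕ} k₀ → k₀ < n → (∀ k → k ≢ k₀ → f k ≡ 0) → ∑< n f ≡ f k₀
∑-single (suc n) zero     _         f≗0 =
  trans (cong (_ +_) (∑-zero n (λ k → f≗0 (suc k) λ ()))) (+-identityʳ _)
∑-single (suc n) (suc k₀) (s≤s k₀<n) f≗0 =
  cong₂ _+_ (f≗0 0 λ ()) (∑-single n k₀ k₀<n (λ k k≢k₀ → f≗0 (suc k) (k≢k₀ ∘ suc-injective)))

when : {P : Set} → Dec P → ℕ → ℕ
when (yes _) x = x
when (no _)  _ = 0

unless : {P : Set} → Dec P → ℕ → ℕ
unless (yes _) _ = 0
unless (no _)  x = x

𝟙 : {P : Set} → Dec P → ℕ
𝟙 p = when p 1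

when-yes : {P : Set} (p : Dec P) {x : ℕ} → P → when p x ≡ x
when-yes (yes _) _  = refl
when-yes (no ¬P) pf = contradiction pf ¬P

when-no : {P : Set} (p : Dec P) {x : ℕ} → ¬ P → when p x ≡ 0
when-no (yes pf) ¬P = contradiction pf ¬P
when-no (no _)   _  = refl

when-zero : {P : Set} (p : Dec P) → when p 0 ≡ 0
when-zero (yes _) = refl
when-zero (no _)  = refl

unless-zero : {P : Set} (p : Dec P) → unless p 0 ≡ 0
unless-zero (yes _) = refl
unless-zero (no _)  = refl

when-⇔ : {P Q : Set} (p : Dec P) (q : Dec Q) {x : ℕ} → (P → Q) → (Q → P) → when p x ≡ when q x
when-⇔ (yes _)  (yes _)  _   _   = refl
when-⇔ (yes pf) (no ¬Q)  P→Q _   = contradiction (P→Q pf) ¬Q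
when-⇔ (no ¬P)  (yes qf) _   Q→P = contradiction (Q→P qf) ¬P
when-⇔ (no _)   (no _)   _   _   = refl

when+unless : {P : Set} (p : Dec P) (x : ℕ) → when p x + unless p x ≡ x
when+unless (yes _) x = +-identityʳ x
when+unless (no _)  x = refl

pattern col₁ = zero
pattern col₂ = suc zero
pattern col₃ = suc (suc zero)

∑col : (Fin 3 → ℕ) → ℕ
∑col f = sum (map f (allFin 3))

∑col-cong : {f g : Fin 3 → ℕ} → (∀ y → f y ≡ g y) → ∑col f ≡ ∑col g
∑col-cong f≗g = cong sum (map-cong f≗g (allFin 3))

∑col-when : {P : Set} (p : Dec P) (f : Fin 3 → ℕ) → ∑col (λ y → when p (f y)) ≡ when p (∑col f)
∑col-when (yes _) f = refl
∑col-when (no _)  f = refl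

∑-∑col-comm : ∀ n (f : ℕ → Fin 3 → ℕ) → ∑[ k < n ] ∑col (f k) ≡ ∑col (λ y → ∑[ k < n ] f k y)
∑-∑col-comm n f = begin
  ∑[ k < n ] (f₁ k + (f₂ k + (f₃ k + 0)))           ≡⟨ ∑-distrib-+ n f₁ _ ⟩
  ∑< n f₁ + ∑[ k < n ] (f₂ k + (f₃ k + 0))          ≡⟨ cong (∑< n f₁ +_) (∑-distrib-+ n f₂ _) ⟩
  ∑< n f₁ + (∑< n f₂ + ∑[ k < n ] (f₃ k + 0))       ≡⟨ cong (λ x → ∑< n f₁ + (∑< n f₂ + x)) (∑-distrib-+ n f₃ (λ _ → 0)) ⟩
  ∑< n f₁ + (∑< n f₂ + (∑< n f₃ + ∑[ k < n ] 0))    ≡⟨ cong (λ x → ∑< n f₁ + (∑< n f₂ + (∑< n f₃ + x))) (∑-zero n (λ _ → refl)) ⟩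
  ∑< n f₁ + (∑< n f₂ + (∑< n f₃ + 0))               ∎
  where
  open ≡-Reasoning
  f₁ f₂ f₃ : ℕ → ℕ
  f₁ k = f k col₁
  f₂ k = f k col₂
  f₃ k = f k col₃

length-filter≡sum-𝟙 : ∀ {A : Set} {P : A → Set} (P? : Decidable P) (xs : List A) →
                      length (filter P? xs) ≡ sum (map (𝟙 ∘ P?) xs)
length-filter≡sum-𝟙 P? []       = refl
length-filter≡sum-𝟙 P? (x ∷ xs) with P? x
... | yes _ = cong suc (length-filter≡sum-𝟙 P? xs)
... | no  _ = length-filter≡sum-𝟙 P? xs

sum-map-concatMap : ∀ {A B : Set} (f : B → ℕ) (g : A → List B) (xs : List A) →
                    sum (map f (concatMap g xs)) ≡ sum (map (λ x → sum (map f (g x))) xs)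
sum-map-concatMap f g []       = refl
sum-map-concatMap f g (x ∷ xs) = begin
  sum (map f (g x ++ concatMap g xs))                ≡⟨ cong sum (map-++ f (g x) _) ⟩
  sum (map f (g x) ++ map f (concatMap g xs))        ≡⟨ sum-++ (map f (g x)) _ ⟩
  sum (map f (g x)) + sum (map f (concatMap g xs))   ≡⟨ cong (_ +_) (sum-map-concatMap f g xs) ⟩
  sum (map f (g x)) + sum (map (λ x → sum (map f (g x))) xs) ∎
  where open ≡-Reasoning

take-++ˡ : ∀ {A : Set} k (u v : List A) → k ≤ length u → take k (u ++ v) ≡ take k u
take-++ˡ zero    u       v _         = refl
take-++ˡ (suc k) (x ∷ u) v (s≤s k≤u) = cong (x ∷_) (take-++ˡ k u v k≤u)

length-∷ʳ : ∀ {A : Set} (u : List A) x → length (u ∷ʳ x) ≡ suc (length u)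
length-∷ʳ []      x = refl
length-∷ʳ (_ ∷ u) x = cong suc (length-∷ʳ u x)

m∸n≡o⇒m≡o+n : ∀ {m n o} → (o ≡ 0 → n ≡ 0) → m ∸ n ≡ o → m ≡ o + n
m∸n≡o⇒m≡o+n {m} {n} o≡0⇒n≡0 m∸n≡o with n ≤? m
... | yes n≤m = trans (sym (m∸n+n≡m n≤m)) (cong (_+ n) m∸n≡o)
... | no  n≰m = contradiction (subst (_≤ m) (sym (o≡0⇒n≡0 o≡0)) z≤n) n≰m
  where
  o≡0 = trans (sym m∸n≡o) (m≤n⇒m∸n≡0 (<⇒≤ (≰⇒> n≰m)))

Word : Set
Word = List (Fin 3)

∑word : ℕ → (Word → ℕ) → ℕ
∑word zero    f = f []
∑word (suc n) f = ∑word n (λ w → ∑col (λ x → f (x ∷ w)))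

∑word-cong : ∀ n {f g : Word → ℕ} → (∀ w → f w ≡ g w) → ∑word n f ≡ ∑word n g
∑word-cong zero    f≗g = f≗g []
∑word-cong (suc n) f≗g = ∑word-cong n (λ w → ∑col-cong (λ x → f≗g (x ∷ w)))

∑word-zero : ∀ n {f : Word → ℕ} → (∀ w → f w ≡ 0) → ∑word n f ≡ 0
∑word-zero n f≗0 = trans (∑word-cong n f≗0) (const-zero n)
  where
  const-zero : ∀ n → ∑word n (λ _ → 0) ≡ 0
  const-zero zero    = refl
  const-zero (suc n) = const-zero n

∑word-when : ∀ n {P : Set} (p : Dec P) (f : Word → ℕ) → ∑word n (λ w → when p (f w)) ≡ when p (∑word n f)
∑word-when n (yes _) f = refl
∑word-when n (no _)  f = ∑word-zero n (λ _ → refl)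

∑word-∷ʳ : ∀ n (f : Word → ℕ) → ∑word (suc n) f ≡ ∑col (λ y → ∑word n (λ w → f (w ∷ʳ y)))
∑word-∷ʳ zero    f = refl
∑word-∷ʳ (suc n) f = ∑word-∷ʳ n (λ w → ∑col (λ x → f (x ∷ w)))

-- allFin 3 normalises to the list of letters used by words, so each step is sum-map-concatMap.
sum-words : ∀ n (f : Word → ℕ) → sum (map f (words n)) ≡ ∑word n f
sum-words zero    f = +-identityʳ (f [])
sum-words (suc n) f = trans (sum-map-concatMap f _ (words n)) (sum-words n _)

sytˢ : Shape → ℕ
sytˢ (a , b , c) = syt a b c

size : Shape → ℕ
size (a , b , c) = a + b + c

sytˢ≡∑word : ∀ s → sytˢ s ≡ ∑word (size s) (𝟙 ∘ isSYT? s)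
sytˢ≡∑word s@(a , b , c) = trans (length-filter≡sum-𝟙 (isSYT? s) (words (size s))) (sum-words (size s) _)

addCell : Fin 3 → Shape → Shape
addCell col₁ (a , b , c) = (suc a , b , c)
addCell col₂ (a , b , c) = (a , suc b , c)
addCell col₃ (a , b , c) = (a , b , suc c)

addCell-injective : ∀ y {s t} → addCell y s ≡ addCell y t → s ≡ t
addCell-injective col₁ refl = refl
addCell-injective col₂ refl = refl
addCell-injective col₃ refl = refl

count-++ : ∀ j (u v : Word) → count j (u ++ v) ≡ count j u + count j v
count-++ j []      v = refl
count-++ j (x ∷ u) v with x ≟ᶠ j
... | yes _ = cong suc (count-++ j u v)
... | no  _ = count-++ j u v

shapeOf-∷ʳ : ∀ w y → shapeOf (w ∷ʳ y) ≡ addCell y (shapeOf w)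
shapeOf-∷ʳ w y
  rewrite count-++ col₁ w (y ∷ []) | count-++ col₂ w (y ∷ []) | count-++ col₃ w (y ∷ [])
  = add-count y
  where
  add-count : ∀ y {a b c} → (a + count col₁ (y ∷ []) , b + count col₂ (y ∷ []) , c + count col₃ (y ∷ []))
                            ≡ addCell y (a , b , c)
  add-count col₁ = cong₂ _,_ (+-comm _ 1) (cong₂ _,_ (+-identityʳ _) (+-identityʳ _))
  add-count col₂ = cong₂ _,_ (+-identityʳ _) (cong₂ _,_ (+-comm _ 1) (+-identityʳ _))
  add-count col₃ = cong₂ _,_ (+-identityʳ _) (cong₂ _,_ (+-identityʳ _) (+-comm _ 1))

PrefixesAreShapes : Word → Set
PrefixesAreShapes w = ∀ {k} → k ≤ length w → IsShape (shapeOf (take k w))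

IsSYT⇒prefixes : ∀ {s w} → IsSYT s w → shapeOf w ≡ s × PrefixesAreShapes w
IsSYT⇒prefixes {w = w} (w↦s , prefixes) = w↦s , λ k≤w → applyUpTo⁻ (λ k → k) (suc (length w)) prefixes (s≤s k≤w)

prefixes⇒IsSYT : ∀ {s w} → shapeOf w ≡ s → PrefixesAreShapes w → IsSYT s w
prefixes⇒IsSYT {w = w} w↦s prefixes = w↦s , applyUpTo⁺₁ (λ k → k) (suc (length w)) (prefixes ∘ ≤-pred)

prefixes-∷ʳ⁻ : ∀ w y → PrefixesAreShapes (w ∷ʳ y) → PrefixesAreShapes w × IsShape (shapeOf (w ∷ʳ y))
prefixes-∷ʳ⁻ w y prefixes =
  (λ {k} k≤w → subst (IsShape ∘ shapeOf) (take-++ˡ k w _ k≤w) (prefixes (≤-trans k≤w w≤w∷ʳy))) ,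
  subst (IsShape ∘ shapeOf) (take-all _ (w ∷ʳ y) ≤-refl) (prefixes ≤-refl)
  where
  w≤w∷ʳy : length w ≤ length (w ∷ʳ y)
  w≤w∷ʳy = ≤-trans (n≤1+n _) (≤-reflexive (sym (length-∷ʳ w y)))

prefixes-∷ʳ⁺ : ∀ w y → PrefixesAreShapes w → IsShape (shapeOf (w ∷ʳ y)) → PrefixesAreShapes (w ∷ʳ y)
prefixes-∷ʳ⁺ w y prefixes whole {k} k≤w∷ʳy with m≤n⇒m<n∨m≡n (≤-trans k≤w∷ʳy (≤-reflexive (length-∷ʳ w y)))
... | inj₁ (s≤s k≤w) = subst (IsShape ∘ shapeOf) (sym (take-++ˡ k w _ k≤w)) (prefixes k≤w)
... | inj₂ refl      = subst (IsShape ∘ shapeOf) (sym (take-all _ (w ∷ʳ y) (≤-reflexive (length-∷ʳ w y)))) whole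

IsSYT-∷ʳ-shape : ∀ {s} w y → IsSYT s (w ∷ʳ y) → s ≡ addCell y (shapeOf w)
IsSYT-∷ʳ-shape w y (w∷ʳy↦s , _) = trans (sym w∷ʳy↦s) (shapeOf-∷ʳ w y)

IsSYT-∷ʳ⁻ : ∀ {t} w y → IsSYT (addCell y t) (w ∷ʳ y) → IsShape (addCell y t) × IsSYT t w
IsSYT-∷ʳ⁻ w y syt =
  let w∷ʳy↦s , prefixes = IsSYT⇒prefixes syt
      prefixes′ , whole = prefixes-∷ʳ⁻ w y prefixes
  in subst IsShape w∷ʳy↦s whole ,
     prefixes⇒IsSYT (addCell-injective y (trans (sym (shapeOf-∷ʳ w y)) w∷ʳy↦s)) prefixes′

IsSYT-∷ʳ⁺ : ∀ {t} w y → IsShape (addCell y t) → IsSYT t w → IsSYT (addCell y t) (w ∷ʳ y)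
IsSYT-∷ʳ⁺ w y shape syt =
  let w↦t , prefixes = IsSYT⇒prefixes syt
      w∷ʳy↦s = trans (shapeOf-∷ʳ w y) (cong (addCell y) w↦t)
  in prefixes⇒IsSYT w∷ʳy↦s (prefixes-∷ʳ⁺ w y prefixes (subst IsShape (sym w∷ʳy↦s) shape))

sytRemove : Fin 3 → Shape → ℕ
sytRemove col₁ (zero  , b , c) = 0
sytRemove col₁ (suc a , b , c) = syt a b c
sytRemove col₂ (a , zero  , c) = 0
sytRemove col₂ (a , suc b , c) = syt a b c
sytRemove col₃ (a , b , zero)  = 0
sytRemove col₃ (a , b , suc c) = syt a b c

𝟙-isSYT-∷ʳ : ∀ y t w → 𝟙 (isSYT? (addCell y t) (w ∷ʳ y)) ≡ when (isShape? (addCell y t)) (𝟙 (isSYT? t w))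
𝟙-isSYT-∷ʳ y t w with isShape? (addCell y t)
... | yes shape = when-⇔ (isSYT? _ _) (isSYT? t w) (proj₂ ∘ IsSYT-∷ʳ⁻ w y) (IsSYT-∷ʳ⁺ w y shape)
... | no ¬shape = when-no (isSYT? _ _) (¬shape ∘ proj₁ ∘ IsSYT-∷ʳ⁻ w y)

∑word-𝟙-isSYT-∷ʳ-addCell : ∀ y t M → size t ≡ M →
  ∑word M (λ w → 𝟙 (isSYT? (addCell y t) (w ∷ʳ y))) ≡ when (isShape? (addCell y t)) (sytˢ t)
∑word-𝟙-isSYT-∷ʳ-addCell y t M refl = begin
  ∑word M (λ w → 𝟙 (isSYT? (addCell y t) (w ∷ʳ y)))               ≡⟨ ∑word-cong M (𝟙-isSYT-∷ʳ y t) ⟩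
  ∑word M (λ w → when (isShape? (addCell y t)) (𝟙 (isSYT? t w)))  ≡⟨ ∑word-when M (isShape? (addCell y t)) _ ⟩
  when (isShape? (addCell y t)) (∑word M (𝟙 ∘ isSYT? t))          ≡⟨ cong (when (isShape? (addCell y t))) (sytˢ≡∑word t) ⟨
  when (isShape? (addCell y t)) (sytˢ t)                           ∎
  where open ≡-Reasoning

∑word-𝟙-isSYT-∷ʳ-≢addCell : ∀ y s M → (∀ t → s ≢ addCell y t) → ∑word M (λ w → 𝟙 (isSYT? s (w ∷ʳ y))) ≡ 0
∑word-𝟙-isSYT-∷ʳ-≢addCell y s M s≢ =
  ∑word-zero M (λ w → when-no (isSYT? s (w ∷ʳ y)) (s≢ (shapeOf w) ∘ IsSYT-∷ʳ-shape w y))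

∑word-𝟙-isSYT-∷ʳ : ∀ y s M → size s ≡ suc M →
  ∑word M (λ w → 𝟙 (isSYT? s (w ∷ʳ y))) ≡ when (isShape? s) (sytRemove y s)
∑word-𝟙-isSYT-∷ʳ col₁ s@(zero , b , c) M _ =
  trans (∑word-𝟙-isSYT-∷ʳ-≢addCell col₁ s M λ { (_ , _ , _) () }) (sym (when-zero (isShape? s)))
∑word-𝟙-isSYT-∷ʳ col₁ (suc a , b , c) M eq =
  ∑word-𝟙-isSYT-∷ʳ-addCell col₁ (a , b , c) M (suc-injective eq)
∑word-𝟙-isSYT-∷ʳ col₂ s@(a , zero , c) M _ =
  trans (∑word-𝟙-isSYT-∷ʳ-≢addCell col₂ s M λ { (_ , _ , _) () }) (sym (when-zero (isShape? s)))
∑word-𝟙-isSYT-∷ʳ col₂ (a , suc b , c) M eq =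
  ∑word-𝟙-isSYT-∷ʳ-addCell col₂ (a , b , c) M (suc-injective (trans (cong (_+ c) (sym (+-suc a b))) eq))
∑word-𝟙-isSYT-∷ʳ col₃ s@(a , b , zero) M _ =
  trans (∑word-𝟙-isSYT-∷ʳ-≢addCell col₃ s M λ { (_ , _ , _) () }) (sym (when-zero (isShape? s)))
∑word-𝟙-isSYT-∷ʳ col₃ (a , b , suc c) M eq =
  ∑word-𝟙-isSYT-∷ʳ-addCell col₃ (a , b , c) M (suc-injective (trans (sym (+-suc (a + b) c)) eq))

branch : Shape → ℕ
branch s = ∑col (λ y → sytRemove y s)

syt-branching-size : ∀ s M → size s ≡ suc M → sytˢ s ≡ when (isShape? s) (branch s)
syt-branching-size s M eq = begin
  sytˢ s                                                 ≡⟨ sytˢ≡∑word s ⟩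
  ∑word (size s) (𝟙 ∘ isSYT? s)                          ≡⟨ cong (λ n → ∑word n (𝟙 ∘ isSYT? s)) eq ⟩
  ∑word (suc M) (𝟙 ∘ isSYT? s)                           ≡⟨ ∑word-∷ʳ M (𝟙 ∘ isSYT? s) ⟩
  ∑col (λ y → ∑word M (λ w → 𝟙 (isSYT? s (w ∷ʳ y))))    ≡⟨ ∑col-cong (λ y → ∑word-𝟙-isSYT-∷ʳ y s M eq) ⟩
  ∑col (λ y → when (isShape? s) (sytRemove y s))         ≡⟨ ∑col-when (isShape? s) (λ y → sytRemove y s) ⟩
  when (isShape? s) (branch s)                           ∎
  where open ≡-Reasoning

syt-branching : ∀ s → s ≢ (0 , 0 , 0) → sytˢ s ≡ when (isShape? s) (branch s)
syt-branching (zero , zero , zero)    s≢∅ = contradiction refl s≢∅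
syt-branching s@(suc a , b , c)       _   = syt-branching-size s (a + b + c) refl
syt-branching s@(zero , suc b , c)    _   = syt-branching-size s (b + c) refl
syt-branching s@(zero , zero , suc c) _   = syt-branching-size s c refl

syt-nonShape : ∀ s → ¬ IsShape s → sytˢ s ≡ 0
syt-nonShape s ¬shape with shape≟ s (0 , 0 , 0)
... | yes refl = contradiction (z≤n , z≤n) ¬shape
... | no  s≢∅  = trans (syt-branching s s≢∅) (when-no (isShape? s) ¬shape)

overcount : Shape → ℕ
overcount s = unless (isShape? s) (branch s)

syt+overcount : ∀ s → s ≢ (0 , 0 , 0) → sytˢ s + overcount s ≡ branch s
syt+overcount s s≢∅ = trans (cong (_+ overcount s) (syt-branching s s≢∅)) (when+unless (isShape? s) (branch s))

overcount≡unless-sytRemove₂ : ∀ a b c → c ≤ b →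
  overcount (a , b , c) ≡ unless (isShape? (a , b , c)) (sytRemove col₂ (a , b , c))
overcount≡unless-sytRemove₂ a b c c≤b with isShape? (a , b , c)
... | yes _     = refl
... | no ¬shape =
  cong₂ _+_ (sytRemove₁≡0 a b≰a)
            (trans (cong (λ x → sytRemove col₂ (a , b , c) + (x + 0)) (sytRemove₃≡0 c)) (+-identityʳ _))
  where
  b≰a : ¬ b ≤ a
  b≰a b≤a = ¬shape (b≤a , c≤b)
  sytRemove₁≡0 : ∀ a → ¬ b ≤ a → sytRemove col₁ (a , b , c) ≡ 0
  sytRemove₁≡0 zero    _   = refl
  sytRemove₁≡0 (suc a) b≰1+a = syt-nonShape (a , b , c) (λ (b≤a , _) → b≰1+a (≤-trans b≤a (n≤1+n a)))
  sytRemove₃≡0 : ∀ c → sytRemove col₃ (a , b , c) ≡ 0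
  sytRemove₃≡0 zero    = refl
  sytRemove₃≡0 (suc c) = syt-nonShape (a , b , c) (b≰a ∘ proj₁)

sytRemove₂-diagonal : ∀ a k → sytRemove col₂ (a , k , k) ≡ 0
sytRemove₂-diagonal a zero    = refl
sytRemove₂-diagonal a (suc k) = syt-nonShape (a , k , suc k) (1+n≰n ∘ proj₂)

overcount-diagonal : ∀ a k → overcount (a , k , k) ≡ 0
overcount-diagonal a k = begin
  overcount (a , k , k)                                       ≡⟨ overcount≡unless-sytRemove₂ a k k ≤-refl ⟩
  unless (isShape? (a , k , k)) (sytRemove col₂ (a , k , k))  ≡⟨ cong (unless (isShape? (a , k , k))) (sytRemove₂-diagonal a k) ⟩
  unless (isShape? (a , k , k)) 0                             ≡⟨ unless-zero (isShape? (a , k , k)) ⟩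
  0                                                           ∎
  where open ≡-Reasoning

overcount-near-shape : ∀ a b c → c ≤ b → overcount (a , suc b , c) ≡ when (a ≟ b) (syt b b c)
overcount-near-shape a b c c≤b =
  trans (overcount≡unless-sytRemove₂ a (suc b) c (≤-trans c≤b (n≤1+n b))) (near (isShape? _) (a ≟ b))
  where
  near : (p : Dec (IsShape (a , suc b , c))) (q : Dec (a ≡ b)) → unless p (syt a b c) ≡ when q (syt b b c)
  near (yes (1+b≤b , _)) (yes refl) = contradiction 1+b≤b (1+n≰n)
  near (yes _)           (no _)     = refl
  near (no _)            (yes refl) = refl
  near (no ¬shape)       (no a≢b)   = syt-nonShape (a , b , c) λ (b≤a , _) →
    ¬shape (≤∧≢⇒< b≤a (a≢b ∘ sym) , ≤-trans c≤b (n≤1+n b))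

-- For i + 2k > n the first column truncates to 0; the list is then no shape, as i + k > 0.
shapeβ : ℕ → ℕ → ℕ → Shape
shapeβ n i k = (n ∸ (i + 2 * k) , i + k , k)

sytˢ-shapeβ-outside : ∀ n i k → n < i + 2 * k → sytˢ (shapeβ n i k) ≡ 0
sytˢ-shapeβ-outside n i k n<i+2k rewrite m≤n⇒m∸n≡0 (<⇒≤ n<i+2k) =
  syt-nonShape (0 , i + k , k) (nonShape i k n<i+2k)
  where
  nonShape : ∀ i k → n < i + 2 * k → ¬ IsShape (0 , i + k , k)
  nonShape (suc i) k       _ (() , _)
  nonShape zero    (suc k) _ (() , _)
  nonShape zero    zero    ()

βterm≡sytˢ-shapeβ : ∀ n i k → βterm n i k ≡ sytˢ (shapeβ n i k)
βterm≡sytˢ-shapeβ n i k with (i + 2 * k) ≤? n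
... | yes _      = refl
... | no  i+2k≰n = sym (sytˢ-shapeβ-outside n i k (≰⇒> i+2k≰n))

β≡∑ : ∀ n i → β n i ≡ ∑[ k < suc n ] sytˢ (shapeβ n i k)
β≡∑ n i = trans (cong sum (map-upTo (βterm n i) (suc n))) (∑-cong (suc n) (βterm≡sytˢ-shapeβ n i))

β≡∑-suc : ∀ m i → β m i ≡ ∑[ k < suc (suc m) ] sytˢ (shapeβ m i k)
β≡∑-suc m i = begin
  β m i                                                         ≡⟨ β≡∑ m i ⟩
  ∑[ k < suc m ] sytˢ (shapeβ m i k)                            ≡⟨ +-identityʳ _ ⟨
  ∑[ k < suc m ] sytˢ (shapeβ m i k) + 0                        ≡⟨ cong (∑< (suc m) (sytˢ ∘ shapeβ m i) +_) (sytˢ-shapeβ-outside m i (suc m) m<i+2[1+m]) ⟨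
  ∑[ k < suc m ] sytˢ (shapeβ m i k) + sytˢ (shapeβ m i (suc m)) ≡⟨ ∑-last (suc m) (sytˢ ∘ shapeβ m i) ⟨
  ∑[ k < suc (suc m) ] sytˢ (shapeβ m i k)                      ∎
  where
  open ≡-Reasoning
  m<i+2[1+m] : m < i + 2 * suc m
  m<i+2[1+m] = ≤-trans (m≤m+n (suc m) _) (m≤n+m _ i)

sytRemove₁-shapeβ : ∀ m i k → sytRemove col₁ (shapeβ (suc m) i k) ≡ sytˢ (shapeβ m i k)
sytRemove₁-shapeβ m i k with (i + 2 * k) ≤? m
... | yes i+2k≤m rewrite +-∸-assoc 1 i+2k≤m = refl
... | no  i+2k≰m rewrite m≤n⇒m∸n≡0 (≰⇒> i+2k≰m) = sym (sytˢ-shapeβ-outside m i k (≰⇒> i+2k≰m))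

sytRemove₃-shapeβ : ∀ m i k → sytRemove col₃ (shapeβ (suc m) i (suc k)) ≡ sytˢ (shapeβ m (suc i) k)
sytRemove₃-shapeβ m i k = cong₂ (λ a b → syt a b k) (cong (suc m ∸_) (i+2[1+k] i k)) (+-suc i k)
  where
  i+2[1+k] : ∀ i k → i + 2 * suc k ≡ 2 + (i + 2 * k)
  i+2[1+k] = solve-∀

shapeβ-nonempty : ∀ m i k → shapeβ (suc m) i k ≢ (0 , 0 , 0)
shapeβ-nonempty m (suc i) k       ()
shapeβ-nonempty m zero    (suc k) ()
shapeβ-nonempty m zero    zero    ()

β-suc+∑overcount : ∀ m i →
  β (suc m) i + ∑[ k < suc (suc m) ] overcount (shapeβ (suc m) i k)
  ≡ β m i + (∑[ k < suc (suc m) ] sytRemove col₂ (shapeβ (suc m) i k) + β m (suc i))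
β-suc+∑overcount m i = begin
  β (suc m) i + ∑< N (overcount ∘ λᵢ)                     ≡⟨ cong (_+ ∑< N (overcount ∘ λᵢ)) (β≡∑ (suc m) i) ⟩
  ∑< N (sytˢ ∘ λᵢ) + ∑< N (overcount ∘ λᵢ)                ≡⟨ ∑-distrib-+ N (sytˢ ∘ λᵢ) (overcount ∘ λᵢ) ⟨
  ∑[ k < N ] (sytˢ (λᵢ k) + overcount (λᵢ k))             ≡⟨ ∑-cong N (λ k → syt+overcount (λᵢ k) (shapeβ-nonempty m i k)) ⟩
  ∑[ k < N ] branch (λᵢ k)                                ≡⟨ ∑-∑col-comm N (λ k y → sytRemove y (λᵢ k)) ⟩
  ∑< N (sytRemove col₁ ∘ λᵢ) + (∑< N (sytRemove col₂ ∘ λᵢ) + (∑< N (sytRemove col₃ ∘ λᵢ) + 0))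
    ≡⟨ cong₂ (λ x y → x + (∑< N (sytRemove col₂ ∘ λᵢ) + y)) ∑first (trans (+-identityʳ _) ∑third) ⟩
  β m i + (∑< N (sytRemove col₂ ∘ λᵢ) + β m (suc i)) ∎
  where
  open ≡-Reasoning
  N = suc (suc m)
  λᵢ = shapeβ (suc m) i
  ∑first : ∑< N (sytRemove col₁ ∘ λᵢ) ≡ β m i
  ∑first = trans (∑-cong N (sytRemove₁-shapeβ m i)) (sym (β≡∑-suc m i))
  ∑third : ∑< N (sytRemove col₃ ∘ λᵢ) ≡ β m (suc i)
  ∑third = trans (∑-cong (suc m) (sytRemove₃-shapeβ m i)) (sym (β≡∑ m (suc i)))

β-suc-zero : ∀ m → β (suc m) 0 ≡ β m 0 + β m 1
β-suc-zero m = begin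
  β (suc m) 0                                                 ≡⟨ +-identityʳ _ ⟨
  β (suc m) 0 + 0                                             ≡⟨ cong (β (suc m) 0 +_) ∑overcount≡0 ⟨
  β (suc m) 0 + ∑< N (overcount ∘ shapeβ (suc m) 0)           ≡⟨ β-suc+∑overcount m 0 ⟩
  β m 0 + (∑< N (sytRemove col₂ ∘ shapeβ (suc m) 0) + β m 1)  ≡⟨ cong (λ x → β m 0 + (x + β m 1)) ∑sytRemove₂≡0 ⟩
  β m 0 + β m 1                                               ∎
  where
  open ≡-Reasoning
  N = suc (suc m)
  ∑overcount≡0 : ∑< N (overcount ∘ shapeβ (suc m) 0) ≡ 0
  ∑overcount≡0 = ∑-zero N (λ k → overcount-diagonal (suc m ∸ (0 + 2 * k)) k)
  ∑sytRemove₂≡0 : ∑< N (sytRemove col₂ ∘ shapeβ (suc m) 0) ≡ 0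
  ∑sytRemove₂≡0 = ∑-zero N (λ k → sytRemove₂-diagonal (suc m ∸ (0 + 2 * k)) k)

overcount-shapeβ : ∀ m j k →
  overcount (shapeβ (suc m) (suc j) k) ≡ when (m ≟ 2 * j + 3 * k) (syt (j + k) (j + k) k)
overcount-shapeβ m j k =
  trans (overcount-near-shape (m ∸ (j + 2 * k)) (j + k) k (m≤n+m k j))
        (when-⇔ (m ∸ (j + 2 * k) ≟ j + k) (m ≟ 2 * j + 3 * k) ⇒ ⇐)
  where
  split : ∀ j k → 2 * j + 3 * k ≡ (j + k) + (j + 2 * k)
  split = solve-∀
  j+k≡0⇒j+2k≡0 : ∀ j k → j + k ≡ 0 → j + 2 * k ≡ 0
  j+k≡0⇒j+2k≡0 zero    zero    _  = refl
  j+k≡0⇒j+2k≡0 zero    (suc k) ()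
  j+k≡0⇒j+2k≡0 (suc j) k       ()
  ⇒ : m ∸ (j + 2 * k) ≡ j + k → m ≡ 2 * j + 3 * k
  ⇒ eq = trans (m∸n≡o⇒m≡o+n (j+k≡0⇒j+2k≡0 j k) eq) (sym (split j k))
  ⇐ : m ≡ 2 * j + 3 * k → m ∸ (j + 2 * k) ≡ j + k
  ⇐ refl = trans (cong (_∸ (j + 2 * k)) (split j k)) (m+n∸n≡m (j + k) (j + 2 * k))

r-residue-2 : ∀ n i → (n ∸ 2 * i) % 3 ≡ 2 →
  r n i ≡ syt ((n + i ∸ 2) / 3) ((n + i ∸ 2) / 3) ((n ∸ 2 * i + 1) / 3)
r-residue-2 n i ≡2 with (n ∸ 2 * i) % 3 ≟ 2
... | yes _  = refl
... | no ≢2 = contradiction ≡2 ≢2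

r-residue-≢2 : ∀ n i → (n ∸ 2 * i) % 3 ≢ 2 → r n i ≡ 0
r-residue-≢2 n i ≢2 with (n ∸ 2 * i) % 3 ≟ 2
... | yes ≡2 = contradiction ≡2 ≢2
... | no _   = refl

diagonal∸ : ∀ j q → suc (2 * j + 3 * suc q) ∸ 2 * suc j ≡ 2 + q * 3
diagonal∸ j q = trans (cong (_∸ 2 * suc j) (eq j q)) (m+n∸m≡n (2 * suc j) (2 + q * 3))
  where
  eq : ∀ j q → suc (2 * j + 3 * suc q) ≡ 2 * suc j + (2 + q * 3)
  eq = solve-∀

r-diagonal : ∀ j q → r (suc (2 * j + 3 * suc q)) (suc j) ≡ syt (j + suc q) (j + suc q) (suc q)
r-diagonal j q = begin
  r n (suc j)                                                    ≡⟨ r-residue-2 n (suc j) residue ⟩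
  syt ((n + suc j ∸ 2) / 3) ((n + suc j ∸ 2) / 3) ((d + 1) / 3)  ≡⟨ cong₂ (λ x y → syt x x y) column₁ column₃ ⟩
  syt (j + suc q) (j + suc q) (suc q)                            ∎
  where
  open ≡-Reasoning
  n = suc (2 * j + 3 * suc q)
  d = n ∸ 2 * suc j
  residue : d % 3 ≡ 2
  residue = trans (cong (_% 3) (diagonal∸ j q)) ([m+kn]%n≡m%n 2 q 3)
  column₁ : (n + suc j ∸ 2) / 3 ≡ j + suc q
  column₁ = trans (cong (λ x → (x ∸ 2) / 3) (eq j q)) (m*n/n≡m (j + suc q) 3)
    where
    eq : ∀ j q → suc (2 * j + 3 * suc q) + suc j ≡ 2 + (j + suc q) * 3
    eq = solve-∀
  column₃ : (d + 1) / 3 ≡ suc q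
  column₃ = trans (cong (λ x → (x + 1) / 3) (diagonal∸ j q)) (trans (cong (_/ 3) (eq q)) (m*n/n≡m (suc q) 3))
    where
    eq : ∀ q → 2 + q * 3 + 1 ≡ suc q * 3
    eq = solve-∀

diagonal⇒residue-2 : ∀ m j k → 2 * suc j ≤ suc m → m ≡ 2 * j + 3 * k → (suc m ∸ 2 * suc j) % 3 ≡ 2
diagonal⇒residue-2 m j zero    2[1+j]≤1+m refl = contradiction (subst (_≤ suc m) (eq j) 2[1+j]≤1+m) (1+n≰n ∘ ≤-pred)
  where
  eq : ∀ j → 2 * suc j ≡ 2 + (2 * j + 3 * 0)
  eq = solve-∀
diagonal⇒residue-2 m j (suc q) _ refl = trans (cong (_% 3) (diagonal∸ j q)) ([m+kn]%n≡m%n 2 q 3)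

residue-2⇒diagonal : ∀ m j → 2 * suc j ≤ suc m → (suc m ∸ 2 * suc j) % 3 ≡ 2 →
  m ≡ 2 * j + 3 * suc ((suc m ∸ 2 * suc j) / 3)
residue-2⇒diagonal m j 2[1+j]≤1+m ≡2 = suc-injective (begin
  suc m                          ≡⟨ m∸n+n≡m 2[1+j]≤1+m ⟨
  d + 2 * suc j                  ≡⟨ cong (_+ 2 * suc j) (trans (m≡m%n+[m/n]*n d 3) (cong (_+ q * 3) ≡2)) ⟩
  2 + q * 3 + 2 * suc j          ≡⟨ eq j q ⟩
  suc (2 * j + 3 * suc q)        ∎)
  where
  open ≡-Reasoning
  d = suc m ∸ 2 * suc j
  q = d / 3
  eq : ∀ j q → 2 + q * 3 + 2 * suc j ≡ suc (2 * j + 3 * suc q)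
  eq = solve-∀

∑-when-diagonal : ∀ m j (g : ℕ → ℕ) k₀ → m ≡ 2 * j + 3 * k₀ →
  ∑[ k < suc (suc m) ] when (m ≟ 2 * j + 3 * k) (g k) ≡ g k₀
∑-when-diagonal m j g k₀ m≡ = trans (∑-single (suc (suc m)) k₀ k₀<2+m off-diagonal) (when-yes (m ≟ _) m≡)
  where
  k₀<2+m : k₀ < suc (suc m)
  k₀<2+m = s≤s (≤-trans (≤-trans (m≤n*m k₀ 3) (≤-trans (m≤n+m (3 * k₀) (2 * j)) (≤-reflexive (sym m≡)))) (n≤1+n m))
  off-diagonal : ∀ k → k ≢ k₀ → when (m ≟ 2 * j + 3 * k) (g k) ≡ 0
  off-diagonal k k≢k₀ = when-no (m ≟ _) λ m≡′ →
    k≢k₀ (*-cancelˡ-≡ k k₀ 3 (+-cancelˡ-≡ (2 * j) (3 * k) (3 * k₀) (trans (sym m≡′) m≡)))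

∑-overcount-shapeβ≡r : ∀ m j → 2 * suc j ≤ suc m →
  ∑[ k < suc (suc m) ] overcount (shapeβ (suc m) (suc j) k) ≡ r (suc m) (suc j)
∑-overcount-shapeβ≡r m j 2[1+j]≤1+m =
  trans (∑-cong N (overcount-shapeβ m j)) (by-residue ((suc m ∸ 2 * suc j) % 3 ≟ 2))
  where
  N = suc (suc m)
  g : ℕ → ℕ
  g k = syt (j + k) (j + k) k
  by-residue : Dec ((suc m ∸ 2 * suc j) % 3 ≡ 2) → ∑[ k < N ] when (m ≟ 2 * j + 3 * k) (g k) ≡ r (suc m) (suc j)
  by-residue (yes ≡2) =
    trans (∑-when-diagonal m j g (suc q) m≡) (sym (subst (λ m → r (suc m) (suc j) ≡ g (suc q)) (sym m≡) (r-diagonal j q)))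
    where
    q = (suc m ∸ 2 * suc j) / 3
    m≡ = residue-2⇒diagonal m j 2[1+j]≤1+m ≡2
  by-residue (no ≢2) =
    trans (∑-zero N (λ k → when-no (m ≟ 2 * j + 3 * k) {g k} (≢2 ∘ diagonal⇒residue-2 m j k 2[1+j]≤1+m)))
          (sym (r-residue-≢2 (suc m) (suc j) ≢2))

β-suc-suc : ∀ m j → 2 * suc j ≤ suc m →
  β (suc m) (suc j) + r (suc m) (suc j) ≡ β m j + β m (suc j) + β m (suc (suc j))
β-suc-suc m j 2[1+j]≤1+m = begin
  β (suc m) (suc j) + r (suc m) (suc j)
    ≡⟨ cong (β (suc m) (suc j) +_) (∑-overcount-shapeβ≡r m j 2[1+j]≤1+m) ⟨
  β (suc m) (suc j) + ∑< (suc (suc m)) (overcount ∘ shapeβ (suc m) (suc j))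
    ≡⟨ β-suc+∑overcount m (suc j) ⟩
  β m (suc j) + (∑< (suc (suc m)) (sytˢ ∘ shapeβ m j) + β m (suc (suc j)))
    ≡⟨ cong (λ x → β m (suc j) + (x + β m (suc (suc j)))) (β≡∑-suc m j) ⟨
  β m (suc j) + (β m j + β m (suc (suc j)))
    ≡⟨ x+[y+z]≡y+x+z (β m (suc j)) (β m j) (β m (suc (suc j))) ⟩
  β m j + β m (suc j) + β m (suc (suc j)) ∎
  where
  open ≡-Reasoning
  x+[y+z]≡y+x+z : ∀ x y z → x + (y + z) ≡ y + x + z
  x+[y+z]≡y+x+z = solve-∀

proposition6 : ((n : ℕ) → 1 ≤ n → β n 0 ≡ β (n ∸ 1) 0 + β (n ∸ 1) 1)
    × ((n i : ℕ) → 2 ≤ n → 1 ≤ i → i ≤ n / 2 →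
    β n i + r n i ≡ β (n ∸ 1) (i ∸ 1) + β (n ∸ 1) i + β (n ∸ 1) (suc i))
proposition6 = first , second
  where
  first : (n : ℕ) → 1 ≤ n → β n 0 ≡ β (n ∸ 1) 0 + β (n ∸ 1) 1
  first (suc m) _ = β-suc-zero m
  second : (n i : ℕ) → 2 ≤ n → 1 ≤ i → i ≤ n / 2 →
    β n i + r n i ≡ β (n ∸ 1) (i ∸ 1) + β (n ∸ 1) i + β (n ∸ 1) (suc i)
  second (suc m) (suc j) _ _ i≤n/2 =
    β-suc-suc m j (subst (_≤ suc m) (*-comm (suc j) 2) (≤-trans (*-monoˡ-≤ 2 i≤n/2) (m/n*n≤m (suc m) 2)))
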